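{- Let $\rho:d\to k^{\mathsf{u}}$ be a non-decreasing sort, $\mathcal{A}\in P(\rho)$, $e:d_0\to d$ an increasing injection and $\mathcal{B}\in P(\rho\circ e)$ with $(\mathcal{A}^e,\mathcal{B})\in\mathrm{ECon}(\rho\circ e)$. Let $\mathcal{C}=\mathcal{A}|_{(e,\mathcal{B})}$. Then $e$ is the unique increasing injection with codomain $d$ such that $(\mathcal{A}^e,\mathcal{C}^e)\in\mathrm{ECon}(\rho\circ e)$. More precisely, if $e_1:d_1\to d$ is an increasing injection with $\mathrm{im}(e_1)\not\supseteq\mathrm{im}(e)$, then $\mathcal{A}^{e_1}=\mathcal{C}^{e_1}$.
   Context: Setting: finite relational language $\mathcal{L}=\{U_i:i<k^{\mathsf{u}}\}\cup\{R_i:i<k\}$ with conventions: each vertex satisfies exactly one $U_i$ ($U(a)=i$); $R_i(a,a)$ never; distinct $a,b$ satisfy exactly one $R_i(a,b)$ ($R(a,b)=i$); an involution $\mathrm{Flip}$ of $k$ fixing $0$ with $R_i(a,b)\iff R_{\mathrm{Flip}(i)}(b,a)$; $R=0$ means no relation. $\mathcal{F}$ a finite set of finite irreducible structures (irreducible: $R(a,b)\neq0$ for distinct $a,b$), $\mathcal{K}=\mathrm{Forb}(\mathcal{F})$. Standing assumption: every $i<k^{\mathsf{u}}$ is non-degenerate (some two-element structure in $\mathcal{K}$ has a vertex of unary $i$ and a nonzero relation). $\mathbf{K}$ is a fixed enumerated left-dense Fra\"iss\'e limit of $\mathcal{K}$ (underlying set $\omega$; $\mathbf{K}_n$ the induced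 structure on $\{0,\dots,n-1\}$; left dense: for every enumerated $\mathbf{B}\in\mathcal{K}$ with $|\mathbf{B}|=m+1$, $\mathbf{B}_m=\mathbf{K}_m$, there is an order-preserving embedding fixing $\{0,\dots,m-1\}$ with $R(f(m),r)=0$ for $m\le r<f(m)$). $T=k^{\mathsf{u}}\times k^{<\omega}$, levels $T(n)$, $\preceq_{lex}$ (unaries first, then lexicographic); coding map $c(n)\in T(n)$, $c(n)^{\mathsf{u}}=U(n)$, $c(n)^{\mathsf{b}}(m)=R(n,m)$; $\mathrm{CT}(n)$ = restrictions to level $n$ of coding nodes. $\mathcal{L}_d$-structures: binary symbols plus unaries $V_0,\dots,V_{d-1}$ partitioning the vertices. For $S=\{s_0\prec_{lex}\dots\prec_{lex}s_{d-1}\}\subseteq T(n)$, $\mathbf{B}[S]$ is the $\mathcal{L}$-structure on $\{0,\dots,n-1\}\cup B$ equal to $\mathbf{K}_n$ there, with binary part of $\mathbf{B}$ on $B$, $U(b)=s_{V(b)}^{\mathsf{u}}$, $R(b,x)=s_{V(b)}^{\mathsf{b}}(x)$; $\mathcal{K}(S)=\{\mathbf{B}:\mathbf{B}[S]\in\mathcal{K}\}$; $P(\rho)=\{\mathcal{K}(S):S\subseteq\mathrm{CT}(n)\text{ some }n,\ (s_j^{\mathsf{u}})_{j<d}=\rho\}$. For any function $e:d_0\to d$ and $\mathcal{L}_{d_0}$-structure $\mathbf{B}$, $e\cdot\mathbf{B}$ is the $\mathcal{L}_d$-structure with same underlying set and binary part and $V^{e\cdot\mathbf{B}}=e\circ V^{\mathbf{B}}$;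 for a class $\mathcal{A}$ of $\mathcal{L}_d$-structures, $\mathcal{A}^e=\{\mathbf{B}:e\cdot\mathbf{B}\in\mathcal{A}\}$. For an injection $e$, $\mathbf{B}^e$ ($\mathbf{B}$ an $\mathcal{L}_d$-structure) is the $\mathcal{L}_{d_0}$-structure on the vertices with $V$-label in $\mathrm{im}(e)$, relabelled by $e^{ -1}$, and $\mathcal{A}|_{(e,\mathcal{B})}=\{\mathbf{B}\in\mathcal{A}:\mathbf{B}^e\in\mathcal{B}\}$. $\mathrm{Con}(\rho)$ is the set of pairs $(\mathcal{A},\mathcal{B})$ with $\mathcal{A},\mathcal{B}\in P(\rho)$, $\mathcal{B}\subsetneq\mathcal{A}$ and no $\mathcal{C}\in P(\rho)$ with $\mathcal{B}\subsetneq\mathcal{C}\subsetneq\mathcal{A}$; $\mathrm{ECon}(\rho)$ is the set of $(\mathcal{A},\mathcal{B})\in\mathrm{Con}(\rho)$ such that $\mathcal{A}^{e'}=\mathcal{B}^{e'}$ for every increasing injection $e':d'\to d$ with $d'<d$. -}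

module Defs where

open import Data.Nat as ℕ using (ℕ; zero; suc; _+_)
open import Data.Fin as Fin using (Fin; zero; suc; toℕ; splitAt; inject₁; fromℕ)
open import Data.Fin.Properties using (any?; _≟_)
open import Data.Sum using (_⊎_; inj₁; inj₂)
open import Data.Product using (Σ; Σ-syntax; ∃; _×_; _,_; proj₁; proj₂)
open import Data.List as List using (List; length; mapMaybe; allFin)
open import Data.List.Membership.Propositional using (_∈_)
open import Data.Maybe using (Maybe; just; nothing)
open import Data.Vec as Vec using (Vec; []; _∷_; tabulate)
open import Data.Empty using (⊥)
open import Relation.Nullary using (¬_; yes; no)
open import Relation.Binary.PropositionalEquality using (_≡_; _≢_)
open import Function using (_∘_; id)

-- U a = the unique i with U_i(a); R a b = the unique i with R_i(a,b).

record Str (ku : ℕ) (B : Set) (n : ℕ) : Set where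
  constructor mkStr
  field
    U : Fin n → Fin ku
    R : Fin n → Fin n → B
open Str public

Conv : ∀ {n} {A : Set} (z : A) (Flip : A → A) (R : Fin n → Fin n → A) → Set
Conv z Flip R = (∀ a → R a a ≡ z) × (∀ a b → R b a ≡ Flip (R a b))

Irreducible : ∀ {ku n} {A : Set} (z : A) → Str ku A n → Set
Irreducible z S = ∀ a b → a ≢ b → R S a b ≢ z

Embedding : ∀ {ku m n} {A : Set} → Str ku A m → Str ku A n → Set
Embedding {m = m} {n} S T =
  Σ (Fin m → Fin n) λ f →
    (∀ a b → f a ≡ f b → a ≡ b) ×
    (∀ a → U T (f a) ≡ U S a) ×
    (∀ a b → R T (f a) (f b) ≡ R S a b)

Forb : ∀ {ku} {A : Set} (z : A) (Flip : A → A) →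
       List (Σ ℕ (Str ku A)) → ∀ {n} → Str ku A n → Set
Forb z Flip 𝓕 S = Conv z Flip (R S) ×
  (∀ {F} → F ∈ 𝓕 → ¬ Embedding (proj₂ F) S)

EmbK : ∀ {ku n} {A : Set} (KU : ℕ → Fin ku) (KR : ℕ → ℕ → A) →
       Str ku A n → (Fin n → ℕ) → Set
EmbK KU KR S f =
  (∀ a b → f a ≡ f b → a ≡ b) ×
  (∀ a → KU (f a) ≡ U S a) ×
  (∀ a b → KR (f a) (f b) ≡ R S a b)

Automorphism : ∀ {ku} {A : Set} (KU : ℕ → Fin ku) (KR : ℕ → ℕ → A) →
               (ℕ → ℕ) → Set
Automorphism KU KR h =
  Σ (ℕ → ℕ) λ h' → (∀ x → h' (h x) ≡ x) × (∀ x → h (h' x) ≡ x) ×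
    (∀ x → KU (h x) ≡ KU x) × (∀ x y → KR (h x) (h y) ≡ KR x y)

-- The standing setting: language, Flip, 𝓕, and the fixed enumerated
-- left-dense Fraïssé limit 𝐊 of 𝒦 = Forb(𝓕).
-- The binary alphabet is Fin (suc k₁) (so k = suc k₁, and 0 = zero).

record Setting : Set where
  field
    ku k₁ : ℕ
    Flip : Fin (suc k₁) → Fin (suc k₁)
    Flip-invol : ∀ i → Flip (Flip i) ≡ i
    Flip-zero : Flip zero ≡ zero
    𝓕 : List (Σ ℕ (Str ku (Fin (suc k₁))))
    𝓕-conv : ∀ {F} → F ∈ 𝓕 → Conv zero Flip (R (proj₂ F))
    𝓕-irred : ∀ {F} → F ∈ 𝓕 → Irreducible zero (proj₂ F)
    KU : ℕ → Fin ku
    KR : ℕ → ℕ → Fin (suc k₁)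
    K-conv : (∀ a → KR a a ≡ zero) × (∀ a b → KR b a ≡ Flip (KR a b))
    K-age⊆ : ∀ {n} (S : Str ku (Fin (suc k₁)) n) (f : Fin n → ℕ) →
             EmbK KU KR S f → Forb zero Flip 𝓕 S
    K-age⊇ : ∀ {n} (S : Str ku (Fin (suc k₁)) n) →
             Forb zero Flip 𝓕 S → Σ (Fin n → ℕ) (EmbK KU KR S)
    K-homog : ∀ {n} (S : Str ku (Fin (suc k₁)) n) (f g : Fin n → ℕ) →
              EmbK KU KR S f → EmbK KU KR S g →
              Σ (ℕ → ℕ) λ h → Automorphism KU KR h × (∀ a → h (f a) ≡ g a)
    K-leftdense : ∀ m (S : Str ku (Fin (suc k₁)) (suc m)) →
      Forb zero Flip 𝓕 S →
      (∀ i → U S (inject₁ i) ≡ KU (toℕ i)) →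
      (∀ i j → R S (inject₁ i) (inject₁ j) ≡ KR (toℕ i) (toℕ j)) →
      Σ (Fin (suc m) → ℕ) λ f → EmbK KU KR S f ×
        (∀ i j → i Fin.< j → f i ℕ.< f j) ×
        (∀ i → f (inject₁ i) ≡ toℕ i) ×
        (∀ r → m ℕ.≤ r → r ℕ.< f (fromℕ m) → KR (f (fromℕ m)) r ≡ zero)
    nondeg : ∀ (i : Fin ku) → Σ (Str ku (Fin (suc k₁)) 2) λ S →
      Forb zero Flip 𝓕 S × Σ (Fin 2) λ a → U S a ≡ i ×
        Σ (Fin 2) λ b → R S a b ≢ zero

Incr : ∀ {d₀ d} → (Fin d₀ → Fin d) → Set
Incr e = ∀ i j → i Fin.< j → e i Fin.< e j

NonDecr : ∀ {d ku} → (Fin d → Fin ku) → Set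
NonDecr ρ = ∀ i j → i Fin.≤ j → ρ i Fin.≤ ρ j

_<lexv_ : ∀ {n m} → Vec (Fin m) n → Vec (Fin m) n → Set
[] <lexv [] = ⊥
(x ∷ xs) <lexv (y ∷ ys) = x Fin.< y ⊎ (x ≡ y × xs <lexv ys)

record LStr (B : Set) (d n : ℕ) : Set where
  constructor mkLStr
  field
    V : Fin n → Fin d
    RB : Fin n → Fin n → B
open LStr public

Class : Set → ℕ → Set₁
Class B d = (n : ℕ) → LStr B d n → Set

_⊆C_ : ∀ {B d} → Class B d → Class B d → Set
𝒜 ⊆C ℬ = ∀ n S → 𝒜 n S → ℬ n S

_≐_ : ∀ {B d} → Class B d → Class B d → Set
𝒜 ≐ ℬ = (𝒜 ⊆C ℬ) × (ℬ ⊆C 𝒜)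

_·_ : ∀ {B d₀ d n} → (Fin d₀ → Fin d) → LStr B d₀ n → LStr B d n
e · S = mkLStr (e ∘ V S) (RB S)

_^_ : ∀ {B d₀ d} → Class B d → (Fin d₀ → Fin d) → Class B d₀
(𝒜 ^ e) n S = 𝒜 n (e · S)

-- 𝐁^e : induced substructure on vertices with label in im(e), relabelled
-- by e⁻¹ (vertices kept in their original order)
preim : ∀ {d₀ d} → (Fin d₀ → Fin d) → Fin d → Maybe (Fin d₀)
preim e y with any? (λ i → e i ≟ y)
... | yes (i , _) = just i
... | no _ = nothing

restrictStep : ∀ {d₀ d n} → (Fin d₀ → Fin d) → (Fin n → Fin d) →
               Fin n → Maybe (Fin n × Fin d₀)
restrictStep e V x with preim e (V x)
... | just i = just (x , i)
... | nothing = nothing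

restrictList : ∀ {B d₀ d n} → (Fin d₀ → Fin d) → LStr B d n → List (Fin n × Fin d₀)
restrictList {n = n} e S = mapMaybe (restrictStep e (V S)) (allFin n)

restrictE : ∀ {B d₀ d n} → (e : Fin d₀ → Fin d) → (S : LStr B d n) →
            LStr B d₀ (length (restrictList e S))
restrictE e S = mkLStr (λ j → proj₂ (List.lookup L j))
                       (λ j j' → RB S (proj₁ (List.lookup L j)) (proj₁ (List.lookup L j')))
  where L = restrictList e S

_∣[_,_] : ∀ {B d₀ d} → Class B d → (Fin d₀ → Fin d) → Class B d₀ → Class B d
(𝒜 ∣[ e , ℬ ]) n S = 𝒜 n S × ℬ _ (restrictE e S)

module _ (σ : Setting) where
  open Setting σ

  Bin : Set
  Bin = Fin (suc k₁)

  -- nodes of T at level n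
  Node : ℕ → Set
  Node n = Fin ku × Vec Bin n

  _≺lex_ : ∀ {n} → Node n → Node n → Set
  (u , s) ≺lex (u' , s') = u Fin.< u' ⊎ (u ≡ u' × s <lexv s')

  -- restriction of the coding node c(m) to level n
  codeRestr : ℕ → (n : ℕ) → Node n
  codeRestr m n = KU m , tabulate (λ i → KR m (toℕ i))

  CT : (n : ℕ) → Node n → Set
  CT n t = Σ ℕ λ m → n ℕ.≤ m × t ≡ codeRestr m n

  -- 𝐁[S], S given by its ≺lex-increasing enumeration s : Fin d → Node n
  relB : ∀ {d n m} → (Fin d → Node n) → LStr Bin d m →
         Fin n ⊎ Fin m → Fin n ⊎ Fin m → Bin
  relB s S (inj₁ x) (inj₁ y) = KR (toℕ x) (toℕ y)
  relB s S (inj₂ b) (inj₂ b') = RB S b b'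
  relB s S (inj₂ b) (inj₁ x) = Vec.lookup (proj₂ (s (V S b))) x
  relB s S (inj₁ x) (inj₂ b) = Flip (Vec.lookup (proj₂ (s (V S b))) x)

  unaB : ∀ {d n m} → (Fin d → Node n) → LStr Bin d m → Fin n ⊎ Fin m → Fin ku
  unaB s S (inj₁ x) = KU (toℕ x)
  unaB s S (inj₂ b) = proj₁ (s (V S b))

  _[_] : ∀ {d n m} → LStr Bin d m → (Fin d → Node n) → Str ku Bin (n + m)
  _[_] {n = n} S s = mkStr (λ v → unaB s S (splitAt n v))
                           (λ v w → relB s S (splitAt n v) (splitAt n w))

  𝒦S : ∀ {d n} → (Fin d → Node n) → Class Bin d
  𝒦S s m S = Forb zero Flip 𝓕 (S [ s ])

  GoodS : ∀ {d n} → (Fin d → Fin ku) → (Fin d → Node n) → Set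
  GoodS {n = n} ρ s = (∀ i j → i Fin.< j → s i ≺lex s j) ×
                      (∀ j → CT n (s j)) × (∀ j → proj₁ (s j) ≡ ρ j)

  InP : ∀ {d} → (Fin d → Fin ku) → Class Bin d → Set
  InP {d} ρ 𝒜 = Σ ℕ λ n → Σ (Fin d → Node n) λ s → GoodS ρ s × (𝒜 ≐ 𝒦S s)

  _⊊_ : ∀ {d} → Class Bin d → Class Bin d → Set
  ℬ ⊊ 𝒜 = (ℬ ⊆C 𝒜) × ¬ (𝒜 ⊆C ℬ)

  Con : ∀ {d} → (Fin d → Fin ku) → Class Bin d → Class Bin d → Set₁
  Con ρ 𝒜 ℬ = InP ρ 𝒜 × InP ρ ℬ × (ℬ ⊊ 𝒜) ×
    (∀ 𝒞 → InP ρ 𝒞 → ℬ ⊊ 𝒞 → 𝒞 ⊊ 𝒜 → ⊥)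

  ECon : ∀ {d} → (Fin d → Fin ku) → Class Bin d → Class Bin d → Set₁
  ECon {d} ρ 𝒜 ℬ = Con ρ 𝒜 ℬ ×
    (∀ d' → d' ℕ.< d → (e' : Fin d' → Fin d) → Incr e' → (𝒜 ^ e') ≐ (ℬ ^ e'))

-- The restriction of 𝒞 = 𝒜|(e,ℬ) back along e is ℬ itself, so (𝒜^e, 𝒞^e) is the
-- given E-consecutive pair. If e₁ misses some label e i₀, then the part of a structure
-- labelled through e₁ that sits over im e never uses i₀; it is therefore labelled through
-- e ∘ punchIn i₀, a lower-dimensional restriction on which 𝒜^e and ℬ agree, and so
-- 𝒜^e₁ = 𝒞^e₁. Consequently an e₁ with (𝒜^e₁, 𝒞^e₁) E-consecutive covers im e, i.e.
-- e = e₁ ∘ f with f increasing; if f were not onto, agreement of 𝒜^e₁ and 𝒞^e₁ below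
-- dimension d₁ would give 𝒜^e = 𝒞^e, so f is an increasing bijection, the identity.

module Submission where

open import Defs
open import Data.Nat using (ℕ)
open import Data.Fin using (Fin)
open import Data.Product using (Σ; ∃; _×_)
open import Relation.Nullary using (¬_)
open import Relation.Binary.PropositionalEquality using (_≡_; subst)
open import Function using (_∘_)

open import Data.Nat as ℕ using (suc; _+_; s≤s; z≤n)
import Data.Nat.Properties as ℕₚ
open import Data.Fin as Fin using (zero; suc; toℕ; inject₁; opposite; punchIn; punchOut; splitAt; join)
import Data.Fin.Properties as Finₚ
open import Data.Sum using (inj₁; inj₂; map₂)
open import Data.Product using (_,_; proj₁; proj₂)
open import Data.Empty using (⊥-elim)
open import Data.List using (List; length; lookup; allFin)
open import Data.List.Membership.Propositional using (_∈_)
open import Data.List.Membership.Propositional.Properties using (∈-lookup; ∈-allFin)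
import Data.List.Relation.Unary.All as All
import Data.List.Relation.Unary.All.Properties as All
import Data.List.Relation.Unary.Any as Any
import Data.List.Relation.Unary.Any.Properties as Any
open import Data.Maybe using (Maybe; just; nothing)
import Data.Maybe.Relation.Unary.All as Maybe
import Data.Maybe.Relation.Unary.Any as Maybe
import Data.Vec as Vec
open import Function using (id; case_of_)
open import Function.Definitions using (Injective)
open import Relation.Binary.Definitions using (tri<; tri≈; tri>)
open import Relation.Binary.PropositionalEquality
  using (refl; sym; trans; cong; cong₂; subst₂; _≢_; _≗_; module ≡-Reasoning)
open import Relation.Nullary using (yes; no)

module _ {a b : ℕ} {f : Fin a → Fin b} (f-incr : Incr f) where

  Incr⇒injective : Injective _≡_ _≡_ f
  Incr⇒injective {i} {j} fi≡fj with Finₚ.<-cmp i j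
  ... | tri< i<j _ _ = ⊥-elim (Finₚ.<-irrefl fi≡fj (f-incr i j i<j))
  ... | tri≈ _ i≡j _ = i≡j
  ... | tri> _ _ j<i = ⊥-elim (Finₚ.<-irrefl (sym fi≡fj) (f-incr j i j<i))

  Incr-reflects-< : ∀ {i j} → f i Fin.< f j → i Fin.< j
  Incr-reflects-< {i} {j} fi<fj with Finₚ.<-cmp i j
  ... | tri< i<j _ _ = i<j
  ... | tri≈ _ refl _ = ⊥-elim (ℕₚ.<-irrefl refl fi<fj)
  ... | tri> _ _ j<i = ⊥-elim (ℕₚ.<-asym fi<fj (f-incr j i j<i))

  Incr⇒≤ : a ℕ.≤ b
  Incr⇒≤ = Finₚ.injective⇒≤ Incr⇒injective

Incr-factor : ∀ {a b c} {g : Fin b → Fin c} {f : Fin a → Fin b} {h : Fin a → Fin c} →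
  Incr g → Incr h → g ∘ f ≗ h → Incr f
Incr-factor g-incr h-incr gf≗h i j i<j =
  Incr-reflects-< g-incr (subst₂ Fin._<_ (sym (gf≗h i)) (sym (gf≗h j)) (h-incr i j i<j))

Incr-inject₁ : ∀ {a b} {f : Fin (suc a) → Fin b} → Incr f → Incr (f ∘ inject₁)
Incr-inject₁ f-incr i j i<j =
  f-incr _ _ (subst₂ ℕ._<_ (sym (Finₚ.toℕ-inject₁ i)) (sym (Finₚ.toℕ-inject₁ j)) i<j)

Incr⇒toℕ≤ : ∀ {a b} {f : Fin a → Fin b} → Incr f → ∀ i → toℕ i ℕ.≤ toℕ (f i)
Incr⇒toℕ≤ f-incr zero = z≤n
Incr⇒toℕ≤ f-incr (suc i) = ℕₚ.≤-trans
  (s≤s (Incr⇒toℕ≤ (Incr-inject₁ f-incr) i))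
  (f-incr (inject₁ i) (suc i) (Finₚ.≤̄⇒inject₁< Finₚ.≤-refl))

opposite-reverses-< : ∀ {n} {i j : Fin n} → i Fin.< j → opposite j Fin.< opposite i
opposite-reverses-< {n} {i} {j} i<j rewrite Finₚ.opposite-prop i | Finₚ.opposite-prop j =
  ℕₚ.∸-monoʳ-< (s≤s i<j) (Finₚ.toℕ<n j)

-- The reversed map opposite ∘ f ∘ opposite is increasing, so it too moves points up.
Incr⇒toℕ≥ : ∀ {n} {f : Fin n → Fin n} → Incr f → ∀ i → toℕ (f i) ℕ.≤ toℕ i
Incr⇒toℕ≥ {n} {f} f-incr i =
  ℕ.s≤s⁻¹ (ℕₚ.∸-cancelʳ-≤ {o = n} (Finₚ.toℕ<n (f i)) opposite-moves-up)
  where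
  reversed-incr : Incr (opposite ∘ f ∘ opposite)
  reversed-incr x y x<y = opposite-reverses-< (f-incr _ _ (opposite-reverses-< x<y))

  opposite-moves-up : n ℕ.∸ suc (toℕ i) ℕ.≤ n ℕ.∸ suc (toℕ (f i))
  opposite-moves-up = subst₂ ℕ._≤_ (Finₚ.opposite-prop i)
    (trans (cong (toℕ ∘ opposite ∘ f) (Finₚ.opposite-involutive i)) (Finₚ.opposite-prop (f i)))
    (Incr⇒toℕ≤ reversed-incr (opposite i))

Incr-endo⇒≗id : ∀ {n} {f : Fin n → Fin n} → Incr f → f ≗ id
Incr-endo⇒≗id f-incr i =
  Finₚ.toℕ-injective (ℕₚ.≤-antisym (Incr⇒toℕ≥ f-incr i) (Incr⇒toℕ≤ f-incr i))

infix 4 _↪_ _↪⟨_⟩_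

record _↪⟨_⟩_ {B : Set} {d₀ d m n : ℕ}
  (T : LStr B d₀ m) (h : Fin d₀ → Fin d) (S : LStr B d n) : Set where
  field
    embed : Fin m → Fin n
    V-embed : ∀ j → h (V T j) ≡ V S (embed j)
    RB-embed : ∀ j j' → RB T j j' ≡ RB S (embed j) (embed j')
open _↪⟨_⟩_

_↪_ : ∀ {B d m n} → LStr B d m → LStr B d n → Set
T ↪ S = T ↪⟨ id ⟩ S

module _ {B : Set} where

  ↪-trans : ∀ {d₀ d₁ d m n p} {T : LStr B d₀ m} {S : LStr B d₁ n} {R : LStr B d p}
    {h : Fin d₀ → Fin d₁} {h' : Fin d₁ → Fin d} →
    T ↪⟨ h ⟩ S → S ↪⟨ h' ⟩ R → T ↪⟨ h' ∘ h ⟩ R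
  ↪-trans {h' = h'} T↪S S↪R = record
    { embed = embed S↪R ∘ embed T↪S
    ; V-embed = λ j → trans (cong h' (V-embed T↪S j)) (V-embed S↪R (embed T↪S j))
    ; RB-embed = λ j j' → trans (RB-embed T↪S j j') (RB-embed S↪R _ _)
    }

  ·-↪ : ∀ {d₀ d m n} {T : LStr B d₀ m} {S : LStr B d n} {h : Fin d₀ → Fin d} →
    T ↪⟨ h ⟩ S → h · T ↪ S
  ·-↪ T↪S = record { embed = embed T↪S ; V-embed = V-embed T↪S ; RB-embed = RB-embed T↪S }

  ↪-·⁻ : ∀ {d₀ d m n} {T : LStr B d₀ m} {S : LStr B d₀ n} {h : Fin d₀ → Fin d} →
    Injective _≡_ _≡_ h → T ↪⟨ h ⟩ h · S → T ↪ S
  ↪-·⁻ h-inj T↪S = record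
    { embed = embed T↪S ; V-embed = h-inj ∘ V-embed T↪S ; RB-embed = RB-embed T↪S }

  ≗⇒·-↪ : ∀ {d₀ d m} {f g : Fin d₀ → Fin d} → f ≗ g → (S : LStr B d₀ m) → f · S ↪ g · S
  ≗⇒·-↪ f≗g S = record { embed = id ; V-embed = f≗g ∘ V S ; RB-embed = λ _ _ → refl }

⊆C-trans : ∀ {B d} {𝒜 ℬ 𝒞 : Class B d} → 𝒜 ⊆C ℬ → ℬ ⊆C 𝒞 → 𝒜 ⊆C 𝒞
⊆C-trans 𝒜⊆ℬ ℬ⊆𝒞 n S = ℬ⊆𝒞 n S ∘ 𝒜⊆ℬ n S

≐-sym : ∀ {B d} {𝒜 ℬ : Class B d} → 𝒜 ≐ ℬ → ℬ ≐ 𝒜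
≐-sym (𝒜⊆ℬ , ℬ⊆𝒜) = ℬ⊆𝒜 , 𝒜⊆ℬ

^-mono : ∀ {B d₀ d} {𝒜 ℬ : Class B d} (e : Fin d₀ → Fin d) → 𝒜 ⊆C ℬ → (𝒜 ^ e) ⊆C (ℬ ^ e)
^-mono e 𝒜⊆ℬ n S = 𝒜⊆ℬ n (e · S)

∣[]-⊆ : ∀ {B d₀ d} {𝒜 : Class B d} {e : Fin d₀ → Fin d} {ℬ : Class B d₀} → (𝒜 ∣[ e , ℬ ]) ⊆C 𝒜
∣[]-⊆ n S = proj₁

Hereditary : ∀ {B d} → Class B d → Set
Hereditary {B} {d} 𝒜 = ∀ {m n} {T : LStr B d m} {S : LStr B d n} → T ↪ S → 𝒜 n S → 𝒜 m T

^-resp-≗ : ∀ {B d₀ d} {𝒜 : Class B d} {f g : Fin d₀ → Fin d} →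
  Hereditary 𝒜 → f ≗ g → (𝒜 ^ f) ⊆C (𝒜 ^ g)
^-resp-≗ 𝒜-her f≗g n S = 𝒜-her (≗⇒·-↪ (sym ∘ f≗g) S)

IsHomomorphism : ∀ {ku m n} {A : Set} → Str ku A m → Str ku A n → (Fin m → Fin n) → Set
IsHomomorphism T S f = (∀ a → U S (f a) ≡ U T a) × (∀ a b → R S (f a) (f b) ≡ R T a b)

-- f need not be injective, but f composed with an embedding of an irreducible F is:
-- merging two vertices of F, related by something ≢ z, would contradict R S x x ≡ z.
Forb-pullback : ∀ {ku m n} {A : Set} {z : A} {Flip : A → A} {𝓕 : List (Σ ℕ (Str ku A))} →
  (∀ {F} → F ∈ 𝓕 → Irreducible z (proj₂ F)) →
  {T : Str ku A m} {S : Str ku A n} {f : Fin m → Fin n} →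
  IsHomomorphism T S f → Forb z Flip 𝓕 S → Forb z Flip 𝓕 T
Forb-pullback {z = z} {Flip} {𝓕} 𝓕-irred {T} {S} {f} (f-U , f-R) ((S-refl , S-flip) , S-forb) =
  (T-refl , T-flip) , T-forb
  where
  T-refl : ∀ a → R T a a ≡ z
  T-refl a = trans (sym (f-R a a)) (S-refl (f a))

  T-flip : ∀ a b → R T b a ≡ Flip (R T a b)
  T-flip a b = trans (sym (f-R b a)) (trans (S-flip (f a) (f b)) (cong Flip (f-R a b)))

  T-forb : ∀ {F} → F ∈ 𝓕 → ¬ Embedding (proj₂ F) T
  T-forb {F} F∈𝓕 (g , g-inj , g-U , g-R) = S-forb F∈𝓕 (f ∘ g , fg-inj , fg-U , fg-R)
    where
    fg-U : ∀ a → U S (f (g a)) ≡ U (proj₂ F) a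
    fg-U a = trans (f-U (g a)) (g-U a)

    fg-R : ∀ a b → R S (f (g a)) (f (g b)) ≡ R (proj₂ F) a b
    fg-R a b = trans (f-R (g a) (g b)) (g-R a b)

    fg-inj : ∀ a b → f (g a) ≡ f (g b) → a ≡ b
    fg-inj a b fga≡fgb with a Finₚ.≟ b
    ... | yes a≡b = a≡b
    ... | no a≢b = ⊥-elim (𝓕-irred F∈𝓕 a b a≢b (begin
      R (proj₂ F) a b             ≡⟨ sym (fg-R a b) ⟩
      R S (f (g a)) (f (g b))     ≡⟨ cong (λ x → R S x (f (g b))) fga≡fgb ⟩
      R S (f (g b)) (f (g b))     ≡⟨ S-refl (f (g b)) ⟩
      z                           ∎))
      where open ≡-Reasoning

module _ (σ : Setting) where
  open Setting σ

  private
    _⟦_⟧ : ∀ {d n m} → LStr (Bin σ) d m → (Fin d → Node σ n) → Str ku (Bin σ) (n + m)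
    S ⟦ s ⟧ = _[_] σ S s

  -- An embedding T ↪ S extends by the identity on the common part {0,…,n-1} of T[s] and S[s].
  ⟦⟧-homomorphism : ∀ {d n m m'} (s : Fin d → Node σ n) {T : LStr (Bin σ) d m'} {S : LStr (Bin σ) d m} →
    (T↪S : T ↪ S) → IsHomomorphism (T ⟦ s ⟧) (S ⟦ s ⟧) (join n m ∘ map₂ (embed T↪S) ∘ splitAt n)
  ⟦⟧-homomorphism {n = n} {m} {m'} s {T} {S} T↪S = hom-U , hom-R
    where
    g : Fin m' → Fin m
    g = embed T↪S

    lift : Fin (n + m') → Fin (n + m)
    lift = join n m ∘ map₂ g ∘ splitAt n

    splitAt-lift : ∀ v → splitAt n (lift v) ≡ map₂ g (splitAt n v)
    splitAt-lift v = Finₚ.splitAt-join n m (map₂ g (splitAt n v))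

    una : ∀ u → unaB σ s S (map₂ g u) ≡ unaB σ s T u
    una (inj₁ x) = refl
    una (inj₂ b) = cong (proj₁ ∘ s) (sym (V-embed T↪S b))

    rel : ∀ u u' → relB σ s S (map₂ g u) (map₂ g u') ≡ relB σ s T u u'
    rel (inj₁ x) (inj₁ y) = refl
    rel (inj₂ b) (inj₂ b') = sym (RB-embed T↪S b b')
    rel (inj₂ b) (inj₁ x) = cong (λ c → Vec.lookup (proj₂ (s c)) x) (sym (V-embed T↪S b))
    rel (inj₁ x) (inj₂ b) = cong (λ c → Flip (Vec.lookup (proj₂ (s c)) x)) (sym (V-embed T↪S b))

    hom-U : ∀ v → U (S ⟦ s ⟧) (lift v) ≡ U (T ⟦ s ⟧) v
    hom-U v rewrite splitAt-lift v = una (splitAt n v)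

    hom-R : ∀ v w → R (S ⟦ s ⟧) (lift v) (lift w) ≡ R (T ⟦ s ⟧) v w
    hom-R v w rewrite splitAt-lift v | splitAt-lift w = rel (splitAt n v) (splitAt n w)

  𝒦S-hereditary : ∀ {d n} (s : Fin d → Node σ n) → Hereditary (𝒦S σ s)
  𝒦S-hereditary s {T = T} {S} T↪S =
    Forb-pullback {Flip = Flip} 𝓕-irred {T ⟦ s ⟧} {S ⟦ s ⟧} (⟦⟧-homomorphism s T↪S)

  InP⇒hereditary : ∀ {d} {ρ : Fin d → Fin ku} {𝒜 : Class (Bin σ) d} → InP σ ρ 𝒜 → Hereditary 𝒜
  InP⇒hereditary (_ , s , _ , 𝒜⊆𝒦S , 𝒦S⊆𝒜) {T = T} T↪S a =
    𝒦S⊆𝒜 _ T (𝒦S-hereditary s T↪S (𝒜⊆𝒦S _ _ a))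

module _ {d₀ d : ℕ} (e : Fin d₀ → Fin d) where

  preim-sound : ∀ {y i} → preim e y ≡ just i → e i ≡ y
  preim-sound {y} eq with Finₚ.any? (λ i → e i Finₚ.≟ y)
  preim-sound refl | yes (_ , ei≡y) = ei≡y

  preim-complete : Injective _≡_ _≡_ e → ∀ i → preim e (e i) ≡ just i
  preim-complete e-inj i with Finₚ.any? (λ j → e j Finₚ.≟ e i)
  ... | yes (j , ej≡ei) = cong just (e-inj ej≡ei)
  ... | no ∄j = ⊥-elim (∄j (i , refl))

  restrictStep-sound : ∀ {n} (W : Fin n → Fin d) x →
    Maybe.All (λ (y , i) → preim e (W y) ≡ just i) (restrictStep e W x)
  restrictStep-sound W x with preim e (W x) in eq
  ... | just i = Maybe.just eq
  ... | nothing = Maybe.nothing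

  restrictStep-complete : ∀ {n} (W : Fin n → Fin d) {x i} →
    preim e (W x) ≡ just i → restrictStep e W x ≡ just (x , i)
  restrictStep-complete W eq rewrite eq = refl

module _ {B : Set} {d₀ d n : ℕ} (e : Fin d₀ → Fin d) (S : LStr B d n) where

  private
    L : List (Fin n × Fin d₀)
    L = restrictList e S

  restrictList-sound : ∀ j → preim e (V S (proj₁ (lookup L j))) ≡ just (proj₂ (lookup L j))
  restrictList-sound j = All.lookup
    (All.mapMaybe⁺ (All.map⁺ (All.tabulate⁺ (restrictStep-sound e (V S))))) (∈-lookup j)

  restrictList-complete : ∀ {x i} → preim e (V S x) ≡ just i →
    Σ (Fin (length L)) λ k → lookup L k ≡ (x , i)
  restrictList-complete {x} {i} eq = Any.index x,i∈L , sym (Any.lookup-index x,i∈L)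
    where
    x,i∈L : (x , i) ∈ L
    x,i∈L = Any.mapMaybe⁺ _ (allFin n) (Any.map⁺ (Any.map
      (λ { refl → subst (Maybe.Any ((x , i) ≡_)) (sym (restrictStep-complete e (V S) eq)) (Maybe.just refl) })
      (∈-allFin x)))

  restrict-↪ : restrictE e S ↪⟨ e ⟩ S
  restrict-↪ = record
    { embed = proj₁ ∘ lookup L
    ; V-embed = preim-sound e ∘ restrictList-sound
    ; RB-embed = λ _ _ → refl
    }

module _ {B : Set} {d₀ d : ℕ} (e : Fin d₀ → Fin d) where

  ↪-restrictE : ∀ {m n} {T : LStr B d₀ m} {S : LStr B d n} (g : Fin m → Fin n) →
    (∀ j → preim e (V S (g j)) ≡ just (V T j)) → (∀ j j' → RB T j j' ≡ RB S (g j) (g j')) →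
    T ↪ restrictE e S
  ↪-restrictE {T = T} {S} g g-V g-RB = record
    { embed = proj₁ ∘ found
    ; V-embed = λ j → cong proj₂ (sym (proj₂ (found j)))
    ; RB-embed = λ j j' → trans (g-RB j j') (cong₂ (RB S) (vertex j) (vertex j'))
    }
    where
    found : ∀ j → Σ _ λ k → lookup (restrictList e S) k ≡ (g j , V T j)
    found j = restrictList-complete e S (g-V j)

    vertex : ∀ j → g j ≡ proj₁ (lookup (restrictList e S) (proj₁ (found j)))
    vertex j = cong proj₁ (sym (proj₂ (found j)))

  restrict-mono : ∀ {m n} {T : LStr B d m} {S : LStr B d n} →
    T ↪ S → restrictE e T ↪ restrictE e S
  restrict-mono {T = T} {S} T↪S = ↪-restrictE {S = S} (embed T↪S ∘ proj₁ ∘ lookup (restrictList e T))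
    (λ j → trans (cong (preim e) (sym (V-embed T↪S _))) (restrictList-sound e T j))
    (λ j j' → RB-embed T↪S _ _)

  restrict-·-↪ : ∀ {n} → Injective _≡_ _≡_ e → (S : LStr B d₀ n) → S ↪ restrictE e (e · S)
  restrict-·-↪ e-inj S = ↪-restrictE id (preim-complete e e-inj ∘ V S) (λ _ _ → refl)

punchIn-incr : ∀ {n} (i₀ : Fin (suc n)) → Incr (punchIn i₀)
punchIn-incr i₀ i j i<j = Finₚ.≤∧≢⇒< (Finₚ.punchIn-mono-≤ i₀ i j (ℕₚ.<⇒≤ i<j))
  (λ eq → Finₚ.<-irrefl (Finₚ.punchIn-injective i₀ i j eq) i<j)

module _ {B : Set} {n m : ℕ} (S : LStr B (suc n) m) {i₀ : Fin (suc n)} (i₀-unused : ∀ x → i₀ ≢ V S x) where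

  dropLabel : LStr B n m
  dropLabel = mkLStr (λ x → punchOut (i₀-unused x)) (RB S)

  punchIn-dropLabel-↪ : punchIn i₀ · dropLabel ↪ S
  punchIn-dropLabel-↪ = record
    { embed = id ; V-embed = λ x → Finₚ.punchIn-punchOut (i₀-unused x) ; RB-embed = λ _ _ → refl }

  ↪-punchIn-dropLabel : S ↪ punchIn i₀ · dropLabel
  ↪-punchIn-dropLabel = record
    { embed = id ; V-embed = λ x → sym (Finₚ.punchIn-punchOut (i₀-unused x)) ; RB-embed = λ _ _ → refl }

AgreeBelow : ∀ {B d} → Class B d → Class B d → Set
AgreeBelow {d = d} 𝒜 ℬ = ∀ d' → d' ℕ.< d → (e' : Fin d' → Fin d) → Incr e' → (𝒜 ^ e') ≐ (ℬ ^ e')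

module _ {B : Set} {d d₀ : ℕ} {𝒜 : Class B d} {e : Fin d₀ → Fin d} {ℬ : Class B d₀}
  (𝒜-her : Hereditary 𝒜) (ℬ-her : Hereditary ℬ) where

  ∣[]-hereditary : Hereditary (𝒜 ∣[ e , ℬ ])
  ∣[]-hereditary T↪S (a , b) = 𝒜-her T↪S a , ℬ-her (restrict-mono e T↪S) b

  ∣[]-^-≐ : Injective _≡_ _≡_ e → ℬ ⊆C (𝒜 ^ e) → ((𝒜 ∣[ e , ℬ ]) ^ e) ≐ ℬ
  ∣[]-^-≐ e-inj ℬ⊆𝒜^e =
    (λ n S (_ , b) → ℬ-her (restrict-·-↪ e e-inj S) b) ,
    (λ n S b → ℬ⊆𝒜^e n S b , ℬ-her (↪-·⁻ e-inj (restrict-↪ e (e · S))) b)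

missed-label⇒^-⊆-∣[]-^ : ∀ {B d d₀ d₁} {𝒜 : Class B d} {e : Fin d₀ → Fin d} {ℬ : Class B d₀} →
  Hereditary 𝒜 → Hereditary ℬ → AgreeBelow (𝒜 ^ e) ℬ →
  (e₁ : Fin d₁ → Fin d) (i₀ : Fin d₀) → ¬ (∃ λ j → e₁ j ≡ e i₀) →
  (𝒜 ^ e₁) ⊆C ((𝒜 ∣[ e , ℬ ]) ^ e₁)
missed-label⇒^-⊆-∣[]-^ {B} {d₀ = suc d₀} {𝒜 = 𝒜} {e} {ℬ} 𝒜-her ℬ-her agree e₁ i₀ e₁-misses n S a =
  a , ℬ-her (↪-punchIn-dropLabel Sₑ i₀-unused) in-ℬ
  where
  Sₑ : LStr B (suc d₀) (length (restrictList e (e₁ · S)))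
  Sₑ = restrictE e (e₁ · S)

  Sₑ↪S : Sₑ ↪⟨ e ⟩ e₁ · S
  Sₑ↪S = restrict-↪ e (e₁ · S)

  i₀-unused : ∀ x → i₀ ≢ V Sₑ x
  i₀-unused x refl = e₁-misses (V S (embed Sₑ↪S x) , sym (V-embed Sₑ↪S x))

  S₀ : LStr B d₀ (length (restrictList e (e₁ · S)))
  S₀ = dropLabel Sₑ i₀-unused

  in-𝒜 : (𝒜 ^ (e ∘ punchIn i₀)) _ S₀
  in-𝒜 = 𝒜-her (·-↪ (↪-trans (punchIn-dropLabel-↪ Sₑ i₀-unused) Sₑ↪S)) a

  in-ℬ : ℬ _ (punchIn i₀ · S₀)
  in-ℬ = proj₁ (agree d₀ (ℕₚ.n<1+n d₀) (punchIn i₀) (punchIn-incr i₀)) _ S₀ in-𝒜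

uncovered⇒^-⊆-∣[]-^ : ∀ {B d d₀ d₁} {𝒜 : Class B d} {e : Fin d₀ → Fin d} {ℬ : Class B d₀} →
  Hereditary 𝒜 → Hereditary ℬ → AgreeBelow (𝒜 ^ e) ℬ →
  (e₁ : Fin d₁ → Fin d) → ¬ (∀ i → ∃ λ j → e₁ j ≡ e i) →
  (𝒜 ^ e₁) ⊆C ((𝒜 ∣[ e , ℬ ]) ^ e₁)
uncovered⇒^-⊆-∣[]-^ {e = e} 𝒜-her ℬ-her agree e₁ uncovered
  with i₀ , e₁-misses ← Finₚ.¬∀⟶∃¬ _ _ (λ i → Finₚ.any? λ j → e₁ j Finₚ.≟ e i) uncovered
  = missed-label⇒^-⊆-∣[]-^ 𝒜-her ℬ-her agree e₁ i₀ e₁-misses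

module _ {d d₀ d₁ : ℕ} {e : Fin d₀ → Fin d} {e₁ : Fin d₁ → Fin d} (e-incr : Incr e) (e₁-incr : Incr e₁)
  (covers : ∀ i → ∃ λ j → e₁ j ≡ e i) where

  factor : Fin d₀ → Fin d₁
  factor = proj₁ ∘ covers

  factor-incr : Incr factor
  factor-incr = Incr-factor e₁-incr e-incr (proj₂ ∘ covers)

  factor-equal : (p : d₁ ≡ d₀) → ∀ i → e₁ i ≡ e (subst Fin p i)
  factor-equal refl i = trans (cong e₁ (sym (Incr-endo⇒≗id factor-incr i))) (proj₂ (covers i))

  -- A strictly larger e₁ would make 𝒜 ^ e and 𝒞 ^ e agree, by restricting along factor.
  covering-label-map-unique : ∀ {B} {𝒜 𝒞 : Class B d} → Hereditary 𝒜 → Hereditary 𝒞 →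
    ¬ ((𝒜 ^ e) ⊆C (𝒞 ^ e)) → AgreeBelow (𝒜 ^ e₁) (𝒞 ^ e₁) →
    Σ (d₁ ≡ d₀) λ p → ∀ i → e₁ i ≡ e (subst Fin p i)
  covering-label-map-unique {𝒜 = 𝒜} {𝒞} 𝒜-her 𝒞-her e-strict agree = p , factor-equal p
    where
    d₁≤d₀ : d₁ ℕ.≤ d₀
    d₁≤d₀ with d₁ ℕ.≤? d₀
    ... | yes d₁≤d₀ = d₁≤d₀
    ... | no d₁≰d₀ = ⊥-elim (e-strict λ n S a →
      ^-resp-≗ 𝒞-her (proj₂ ∘ covers) n S
        (proj₁ (agree d₀ (ℕₚ.≰⇒> d₁≰d₀) factor factor-incr) n S
          (^-resp-≗ 𝒜-her (sym ∘ proj₂ ∘ covers) n S a)))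

    p : d₁ ≡ d₀
    p = ℕₚ.≤-antisym d₁≤d₀ (Incr⇒≤ factor-incr)

module _ (σ : Setting) where
  open Setting σ

  InP-resp-≐ : ∀ {d} {ρ : Fin d → Fin ku} {ℬ ℬ' : Class (Bin σ) d} → InP σ ρ ℬ → ℬ ≐ ℬ' → InP σ ρ ℬ'
  InP-resp-≐ (N , s , s-good , ℬ⊆𝒦S , 𝒦S⊆ℬ) (ℬ⊆ℬ' , ℬ'⊆ℬ) =
    N , s , s-good , ⊆C-trans ℬ'⊆ℬ ℬ⊆𝒦S , ⊆C-trans 𝒦S⊆ℬ ℬ⊆ℬ'

  ECon-resp-≐ : ∀ {d} {ρ : Fin d → Fin ku} {𝒜 ℬ ℬ' : Class (Bin σ) d} →
    ECon σ ρ 𝒜 ℬ → ℬ ≐ ℬ' → ECon σ ρ 𝒜 ℬ'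
  ECon-resp-≐ ((𝒜∈P , ℬ∈P , (ℬ⊆𝒜 , 𝒜⊈ℬ) , maximal) , agree) (ℬ⊆ℬ' , ℬ'⊆ℬ) =
    ( 𝒜∈P
    , InP-resp-≐ ℬ∈P (ℬ⊆ℬ' , ℬ'⊆ℬ)
    , (⊆C-trans ℬ'⊆ℬ ℬ⊆𝒜 , λ 𝒜⊆ℬ' → 𝒜⊈ℬ (⊆C-trans 𝒜⊆ℬ' ℬ'⊆ℬ))
    , λ 𝒞 𝒞∈P (ℬ'⊆𝒞 , 𝒞⊈ℬ') → maximal 𝒞 𝒞∈P (⊆C-trans ℬ⊆ℬ' ℬ'⊆𝒞 , λ 𝒞⊆ℬ → 𝒞⊈ℬ' (⊆C-trans 𝒞⊆ℬ ℬ⊆ℬ'))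
    ) ,
    λ d' d'<d e' e'-incr → let (𝒜⊆ℬ , ℬ⊆𝒜) = agree d' d'<d e' e'-incr in
      ⊆C-trans 𝒜⊆ℬ (^-mono e' ℬ⊆ℬ') , ⊆C-trans (^-mono e' ℬ'⊆ℬ) ℬ⊆𝒜

  ECon⇒⊇ : ∀ {d} {ρ : Fin d → Fin ku} {𝒜 ℬ : Class (Bin σ) d} → ECon σ ρ 𝒜 ℬ → ℬ ⊆C 𝒜
  ECon⇒⊇ ((_ , _ , (ℬ⊆𝒜 , _) , _) , _) = ℬ⊆𝒜

  ECon⇒⊉ : ∀ {d} {ρ : Fin d → Fin ku} {𝒜 ℬ : Class (Bin σ) d} → ECon σ ρ 𝒜 ℬ → ¬ (𝒜 ⊆C ℬ)
  ECon⇒⊉ ((_ , _ , (_ , 𝒜⊈ℬ) , _) , _) = 𝒜⊈ℬ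

  ECon⇒AgreeBelow : ∀ {d} {ρ : Fin d → Fin ku} {𝒜 ℬ : Class (Bin σ) d} → ECon σ ρ 𝒜 ℬ → AgreeBelow 𝒜 ℬ
  ECon⇒AgreeBelow = proj₂

proposition4p27 : (σ : Setting) → ∀ {d d₀ : ℕ}
  (ρ : Fin d → Fin (Setting.ku σ)) → NonDecr ρ →
  (𝒜 : Class (Bin σ) d) → InP σ ρ 𝒜 →
  (e : Fin d₀ → Fin d) → Incr e →
  (ℬ : Class (Bin σ) d₀) → InP σ (ρ ∘ e) ℬ →
  ECon σ (ρ ∘ e) (𝒜 ^ e) ℬ →
  ECon σ (ρ ∘ e) (𝒜 ^ e) ((𝒜 ∣[ e , ℬ ]) ^ e)
  × (∀ (d₁ : ℕ) (e₁ : Fin d₁ → Fin d) → Incr e₁ →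
       ECon σ (ρ ∘ e₁) (𝒜 ^ e₁) ((𝒜 ∣[ e , ℬ ]) ^ e₁) →
       Σ (d₁ ≡ d₀) (λ p → ∀ i → e₁ i ≡ e (subst Fin p i)))
  × (∀ (d₁ : ℕ) (e₁ : Fin d₁ → Fin d) → Incr e₁ →
       ¬ (∀ i → ∃ (λ j → e₁ j ≡ e i)) →
       (𝒜 ^ e₁) ≐ ((𝒜 ∣[ e , ℬ ]) ^ e₁))
proposition4p27 σ {d} ρ _ 𝒜 𝒜∈P e e-incr ℬ ℬ∈P ℬ-econ =
  𝒞-econ ,
  (λ d₁ e₁ e₁-incr e₁-econ → case Finₚ.all? (λ i → Finₚ.any? λ j → e₁ j Finₚ.≟ e i) of λ where
    (yes covered) → covering-label-map-unique e-incr e₁-incr covered 𝒜-her 𝒞-her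
                      (ECon⇒⊉ σ 𝒞-econ) (ECon⇒AgreeBelow σ e₁-econ)
    (no uncovered) → ⊥-elim (ECon⇒⊉ σ e₁-econ (uncovered-⊆ e₁ uncovered))) ,
  (λ d₁ e₁ _ uncovered → uncovered-⊆ e₁ uncovered , ^-mono {ℬ = 𝒜} e₁ (∣[]-⊆ {e = e} {ℬ}))
  where
  𝒜-her : Hereditary 𝒜
  𝒜-her = InP⇒hereditary σ 𝒜∈P

  ℬ-her : Hereditary ℬ
  ℬ-her = InP⇒hereditary σ ℬ∈P

  𝒞-her : Hereditary (𝒜 ∣[ e , ℬ ])
  𝒞-her = ∣[]-hereditary 𝒜-her ℬ-her

  𝒞-econ : ECon σ (ρ ∘ e) (𝒜 ^ e) ((𝒜 ∣[ e , ℬ ]) ^ e)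
  𝒞-econ = ECon-resp-≐ σ ℬ-econ
    (≐-sym (∣[]-^-≐ 𝒜-her ℬ-her (Incr⇒injective e-incr) (ECon⇒⊇ σ ℬ-econ)))

  uncovered-⊆ : ∀ {d₁} (e₁ : Fin d₁ → Fin d) → ¬ (∀ i → ∃ λ j → e₁ j ≡ e i) →
    (𝒜 ^ e₁) ⊆C ((𝒜 ∣[ e , ℬ ]) ^ e₁)
  uncovered-⊆ = uncovered⇒^-⊆-∣[]-^ 𝒜-her ℬ-her (ECon⇒AgreeBelow σ ℬ-econ)
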